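{- For every positive integer $d$ and every integer $m$ with $0\le m\le d$, $$2^m(d-m)!\,a(K_d,m)=\sum_{\sigma\in S_d}a(G_\sigma,m).$$
   Context: $K_d$ is the complete graph on $d$ vertices. For $\sigma\in S_d$, $G_\sigma$ is the directed graph with vertex set $[d]$ and one directed edge $s\to\sigma(s)$ for each $s\in[d]$ (fixed points give loops; a $2$-cycle $(a\,b)$ gives two distinct edges $a\to b$ and $b\to a$). A matching of a graph is a set of edges, none of them loops, no two of which share an endpoint; $a(G,m)$ is the number of matchings of $G$ with exactly $m$ edges. -}

module Defs where

open import Data.Nat using (ℕ; zero; suc; _<_; _<?_)
open import Data.Bool using (Bool; true; false)
open import Data.Fin using (Fin; toℕ) renaming (_≟_ to _≟ᶠ_)
open import Data.Fin.Properties using (all?)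
open import Data.Fin.Subset using (Subset; _∈_; ∣_∣)
open import Data.Fin.Subset.Properties using (_∈?_)
open import Data.List using (List; []; _∷_; map; concatMap; filter; length; allFin)
open import Data.Vec using (Vec; []; _∷_; lookup)
open import Data.Product using (_×_; _,_; proj₁; proj₂)
open import Relation.Binary.PropositionalEquality using (_≡_; _≢_)
open import Relation.Nullary using (Dec; ¬_)
open import Relation.Nullary.Decidable using (_×-dec_; _→-dec_; ¬?)
open import Data.Nat using (_≟_)

-- Each edge is an (ordered) pair of endpoints; loops (u , u) are allowed,
-- and repeated/parallel edges are distinct list entries.
Graph : ℕ → Set
Graph d = List (Fin d × Fin d)

Edge : ∀ {d} → Graph d → Set
Edge G = Fin (length G)

ends : ∀ {d} (G : Graph d) → Edge G → Fin d × Fin d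
ends G e = Data.List.lookup G e

IsLoop : ∀ {d} (G : Graph d) → Edge G → Set
IsLoop G e = proj₁ (ends G e) ≡ proj₂ (ends G e)

NoCommonEndpoint : ∀ {d} → Fin d × Fin d → Fin d × Fin d → Set
NoCommonEndpoint (u , v) (u' , v') = u ≢ u' × u ≢ v' × v ≢ u' × v ≢ v'

IsMatching : ∀ {d} (G : Graph d) → Subset (length G) → Set
IsMatching G S =
  (∀ e → e ∈ S → ¬ IsLoop G e) ×
  (∀ e e' → e ∈ S → e' ∈ S → e ≢ e' → NoCommonEndpoint (ends G e) (ends G e'))

noCommon? : ∀ {d} (p q : Fin d × Fin d) → Dec (NoCommonEndpoint p q)
noCommon? (u , v) (u' , v') =
  ¬? (u ≟ᶠ u') ×-dec ¬? (u ≟ᶠ v') ×-dec ¬? (v ≟ᶠ u') ×-dec ¬? (v ≟ᶠ v')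

isMatching? : ∀ {d} (G : Graph d) (S : Subset (length G)) → Dec (IsMatching G S)
isMatching? G S =
  all? (λ e → (e ∈? S) →-dec ¬? (proj₁ (ends G e) ≟ᶠ proj₂ (ends G e))) ×-dec
  all? (λ e → all? (λ e' → (e ∈? S) →-dec ((e' ∈? S) →-dec
        (¬? (e ≟ᶠ e') →-dec noCommon? (ends G e) (ends G e')))))

allSubsets : ∀ n → List (Subset n)
allSubsets zero = [] ∷ []
allSubsets (suc n) = concatMap (λ S → (false ∷ S) ∷ (true ∷ S) ∷ []) (allSubsets n)

a : ∀ {d} → Graph d → ℕ → ℕ
a G m = length (filter (λ S → isMatching? G S ×-dec (∣ S ∣ ≟ m)) (allSubsets (length G)))

K : ∀ d → Graph d
K d = concatMap (λ i → map (λ j → (i , j)) (filter (λ j → toℕ i <? toℕ j) (allFin d))) (allFin d)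

allVecs : ∀ n k → List (Vec (Fin k) n)
allVecs zero k = [] ∷ []
allVecs (suc n) k = concatMap (λ v → map (λ x → x ∷ v) (allFin k)) (allVecs n k)

-- σ is injective (equivalently, a permutation of the finite set Fin d)
IsPerm : ∀ {d} → Vec (Fin d) d → Set
IsPerm σ = ∀ i j → lookup σ i ≡ lookup σ j → i ≡ j

isPerm? : ∀ {d} (σ : Vec (Fin d) d) → Dec (IsPerm σ)
isPerm? σ = all? (λ i → all? (λ j → (lookup σ i ≟ᶠ lookup σ j) →-dec (i ≟ᶠ j)))

Sym : ∀ d → List (Vec (Fin d) d)
Sym d = filter isPerm? (allVecs d d)

Gσ : ∀ {d} → Vec (Fin d) d → Graph d
Gσ {d} σ = map (λ s → (s , lookup σ s)) (allFin d)

-- Bijective proof: both sides are cardinalities of finite types.  A permutation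
-- σ with an m-matching M of G_σ is determined by the set S of tails of the arcs
-- s → σ(s) in M, hence by R = σ|S, an *oriented matching* (a partial injection
-- with m arcs, no arc ending where another starts), together with σ, an arbitrary
-- permutation extending R.  Each R has (d ∸ m)! extensions (the bijections from
-- the complement of its domain onto that of its image), and oriented m-matchings
-- are the m-matchings of K_d with a subset of edges traversed from the larger to
-- the smaller vertex: 2^m choices.
module Submission where

open import Defs
open import Axiom.UniquenessOfIdentityProofs using (module Decidable⇒UIP)
open import Data.Bool using (Bool; true; false; T; not; _∧_; _∨_)
open import Data.Bool.Properties using (T-irrelevant; T-≡; ∧-idem; T-∧; T-not-≡)
open import Data.Empty using (⊥; ⊥-elim)
open import Data.Fin using (Fin; zero; suc; punchIn; punchOut; toℕ) renaming (_≟_ to _≟ᶠ_)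
open import Data.Fin.Permutation using (↔⇒≡)
open import Data.Fin.Properties using (+↔⊎; 0↔⊥; 1↔⊤; all?; *↔×; suc-injective; punchOut-injective; punchIn-punchOut; punchOut-punchIn; punchOut-cong; punchInᵢ≢i; punchIn-injective; any?; <-cmp)
open import Data.Fin.Subset using (Subset; ∣_∣) renaming (_∈_ to _∈ₛ_)
open import Data.List using (List; []; _∷_; map; filter; length; concatMap; allFin)
import Data.List as List
open import Data.List.Relation.Unary.Any using (Any; here; there)
open import Data.List.Relation.Unary.Any.Properties using (Any-cong; map↔; concat↔; ∷↔; ⊥↔Any[]; pure↔)
open import Data.Nat using (ℕ; zero; suc; _+_; _*_; _∸_; _^_; _!; _<?_; _<_; _≤_) renaming (_≟_ to _≟ℕ_)
open import Data.Nat.ListAction using (sum)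
open import Data.Nat.Properties using (m+n∸m≡n; +-identityʳ; <-irrefl; <-asym)
open import Data.Product using (Σ; _×_; _,_; proj₁; proj₂)
open import Data.Product.Function.Dependent.Propositional using (Σ-↔)
open import Data.Product.Function.NonDependent.Propositional using (_×-↔_)
open import Data.Sum using (_⊎_; inj₁; inj₂; [_,_]′)
open import Data.Sum.Function.Propositional using (_⊎-↔_)
open import Data.Unit using (⊤; tt)
open import Data.Vec using (Vec; []; _∷_; lookup; tabulate) renaming (map to vmap)
open import Data.Vec.Properties using (lookup∘tabulate; tabulate∘lookup; tabulate-cong; []=⇒lookup; lookup⇒[]=; lookup-map)
open import Function using (_∘_; id; const)
open import Function.Bundles using (_↔_; mk↔ₛ′; Inverse; Injection; Equivalence)
open import Function.Properties.Inverse using (↔-refl; ↔-sym; ↔-trans; Inverse⇒Injection)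
open import Function.Related.TypeIsomorphisms using (Σ-distribˡ-⊎; ∃∃↔∃∃)
open import Relation.Binary.Definitions using (tri<; tri≈; tri>)
open import Relation.Binary.PropositionalEquality using (_≡_; refl; sym; trans; cong; subst; _≢_; cong₂; subst₂)
open import Relation.Nullary using (Dec; yes; no; ¬_)
open import Relation.Nullary.Decidable using (True; isYes; toWitness; fromWitness; _→-dec_; T?; _×-dec_; ¬?; ⌊_⌋)
open import Relation.Unary using (Decidable)

-- Every count in this file is the cardinality of a type, compared through explicit
-- bijections; _⟨↔⟩_ composes them in diagrammatic order.
infixr 2 _⟨↔⟩_
_⟨↔⟩_ : ∀ {A B C : Set} → A ↔ B → B ↔ C → A ↔ C
_⟨↔⟩_ = ↔-trans

≡⇒↔ : ∀ {A B : Set} → A ≡ B → A ↔ B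
≡⇒↔ refl = ↔-refl

Σ-fibres : ∀ {A : Set} {B C : A → Set} → (∀ a → B a ↔ C a) → Σ A B ↔ Σ A C
Σ-fibres f = Σ-↔ ↔-refl (λ {a} → f a)

Σ-reindex : ∀ {A A' : Set} {B : A' → Set} (e : A ↔ A') → Σ A (B ∘ Inverse.to e) ↔ Σ A' B
Σ-reindex e = Σ-↔ e ↔-refl

↔-to-injective : ∀ {A B : Set} (e : A ↔ B) {x y : A} → Inverse.to e x ≡ Inverse.to e y → x ≡ y
↔-to-injective e = Injection.injective (Inverse⇒Injection e)

↔-from-injective : ∀ {A B : Set} (e : A ↔ B) {x y : B} → Inverse.from e x ≡ Inverse.from e y → x ≡ y
↔-from-injective e = ↔-to-injective (↔-sym e)

Σ-≡ : ∀ {A : Set} {B : A → Set} → (∀ a (x y : B a) → x ≡ y) →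
      ∀ {a a' : A} {b : B a} {b' : B a'} → a ≡ a' → (a , b) ≡ (a' , b')
Σ-≡ irr {a} {b = b} {b'} refl = cong (a ,_) (irr a b b')

True-↔ : ∀ {P Q : Set} (P? : Dec P) (Q? : Dec Q) → (P → Q) → (Q → P) → True P? ↔ True Q?
True-↔ (yes p) (yes q) f g = ↔-refl
True-↔ (yes p) (no ¬q) f g = ⊥-elim (¬q (f p))
True-↔ (no ¬p) (yes q) f g = ⊥-elim (¬p (g q))
True-↔ (no ¬p) (no ¬q) f g = ↔-refl

Σ-Fin-suc : ∀ {n} {B : Fin (suc n) → Set} → Σ (Fin (suc n)) B ↔ (B zero ⊎ Σ (Fin n) (B ∘ suc))
Σ-Fin-suc = mk↔ₛ′ (λ { (zero , b) → inj₁ b ; (suc i , b) → inj₂ (i , b) })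
                  [ (λ b → zero , b) , (λ { (i , b) → suc i , b }) ]′
                  (λ { (inj₁ _) → refl ; (inj₂ _) → refl }) (λ { (zero , b) → refl ; (suc i , b) → refl })

Σ-Bool : ∀ {B : Bool → Set} → Σ Bool B ↔ (B false ⊎ B true)
Σ-Bool = mk↔ₛ′ (λ { (false , b) → inj₁ b ; (true , b) → inj₂ b }) [ (false ,_) , (true ,_) ]′
  (λ { (inj₁ _) → refl ; (inj₂ _) → refl }) (λ { (false , b) → refl ; (true , b) → refl })

Σ-Vec-zero : ∀ {A : Set} {B : Vec A 0 → Set} → B [] ↔ Σ (Vec A 0) B
Σ-Vec-zero = mk↔ₛ′ ([] ,_) (λ { ([] , b) → b }) (λ { ([] , b) → refl }) (λ _ → refl)

Σ-Vec-suc : ∀ {A : Set} {n} {B : Vec A (suc n) → Set} →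
            Σ (Vec A n) (λ v → Σ A (λ x → B (x ∷ v))) ↔ Σ (Vec A (suc n)) B
Σ-Vec-suc = mk↔ₛ′ (λ { (v , x , b) → x ∷ v , b }) (λ { (x ∷ v , b) → v , x , b })
  (λ { (x ∷ v , b) → refl }) (λ { (v , x , b) → refl })

⊎-absorbˡ : ∀ {A C : Set} → ¬ C → A ↔ (C ⊎ A)
⊎-absorbˡ ¬c = mk↔ₛ′ inj₂ [ ⊥-elim ∘ ¬c , id ]′ (λ { (inj₁ c) → ⊥-elim (¬c c) ; (inj₂ _) → refl }) (λ _ → refl)

⊎-absorbʳ : ∀ {A C : Set} → ¬ C → A ↔ (A ⊎ C)
⊎-absorbʳ ¬c = mk↔ₛ′ inj₁ [ id , ⊥-elim ∘ ¬c ]′ (λ { (inj₁ _) → refl ; (inj₂ c) → ⊥-elim (¬c c) }) (λ _ → refl)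

Fin-length : ∀ {A : Set} (xs : List A) → Fin (length xs) ↔ Any (const ⊤) xs
Fin-length [] = 0↔⊥ ⟨↔⟩ ⊥↔Any[]
Fin-length (x ∷ xs) = +↔⊎ {1} ⟨↔⟩ (1↔⊤ ⊎-↔ Fin-length xs) ⟨↔⟩ ∷↔ _

Fin-sum : ∀ {A : Set} (f : A → ℕ) (xs : List A) → Fin (sum (map f xs)) ↔ Any (Fin ∘ f) xs
Fin-sum f [] = 0↔⊥ ⟨↔⟩ ⊥↔Any[]
Fin-sum f (x ∷ xs) = +↔⊎ ⟨↔⟩ (↔-refl ⊎-↔ Fin-sum f xs) ⟨↔⟩ ∷↔ _

Any-single : ∀ {A : Set} {B : A → Set} {x} → Any B (x ∷ []) ↔ B x
Any-single = ↔-sym pure↔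

Any-filter : ∀ {A : Set} {P : A → Set} (P? : Decidable P) {B : A → Set} (xs : List A) →
             Any B (filter P? xs) ↔ Any (λ x → True (P? x) × B x) xs
Any-filter P? [] = ↔-sym ⊥↔Any[] ⟨↔⟩ ⊥↔Any[]
Any-filter P? {B} (x ∷ xs) with P? x in eq
... | yes _ = ↔-sym (∷↔ _) ⟨↔⟩ (kept ⊎-↔ Any-filter P? xs) ⟨↔⟩ ∷↔ _
  where
  kept : B x ↔ (True (P? x) × B x)
  kept rewrite eq = mk↔ₛ′ (tt ,_) proj₂ (λ _ → refl) (λ _ → refl)
... | no _ = Any-filter P? xs ⟨↔⟩ ⊎-absorbˡ dropped ⟨↔⟩ ∷↔ _
  where
  dropped : ¬ (True (P? x) × B x)
  dropped rewrite eq = proj₁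

Any-tabulate : ∀ {A : Set} {B : A → Set} n (f : Fin n → A) → Any B (List.tabulate f) ↔ Σ (Fin n) (B ∘ f)
Any-tabulate zero f = ↔-sym ⊥↔Any[] ⟨↔⟩ mk↔ₛ′ (λ ()) (λ ()) (λ ()) (λ ())
Any-tabulate (suc n) f = ↔-sym (∷↔ _) ⟨↔⟩ (↔-refl ⊎-↔ Any-tabulate n (f ∘ suc)) ⟨↔⟩ ↔-sym Σ-Fin-suc

Any-concatMap : ∀ {A C : Set} {B : C → Set} (f : A → List C) (xs : List A) →
                Any B (concatMap f xs) ↔ Any (Any B ∘ f) xs
Any-concatMap f xs = ↔-sym (map↔ ⟨↔⟩ concat↔)

Any-allVecs : ∀ n k {B : Vec (Fin k) n → Set} → Any B (allVecs n k) ↔ Σ (Vec (Fin k) n) B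
Any-allVecs zero k = Any-single ⟨↔⟩ Σ-Vec-zero
Any-allVecs (suc n) k =
  Any-concatMap _ (allVecs n k) ⟨↔⟩
  Any-cong (λ v → ↔-sym map↔ ⟨↔⟩ Any-tabulate k id) ↔-refl ⟨↔⟩
  Any-allVecs n k ⟨↔⟩ Σ-Vec-suc

Any-allSubsets : ∀ n {B : Subset n → Set} → Any B (allSubsets n) ↔ Σ (Subset n) B
Any-allSubsets zero = Any-single ⟨↔⟩ Σ-Vec-zero
Any-allSubsets (suc n) =
  Any-concatMap _ (allSubsets n) ⟨↔⟩
  Any-cong (λ S → ↔-sym (∷↔ _) ⟨↔⟩ (↔-refl ⊎-↔ Any-single) ⟨↔⟩ ↔-sym Σ-Bool) ↔-refl ⟨↔⟩
  Any-allSubsets n ⟨↔⟩ Σ-Vec-suc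

vec-ext : ∀ {A : Set} {n} {u v : Vec A n} → (∀ i → lookup u i ≡ lookup v i) → u ≡ v
vec-ext {u = u} {v} h = trans (sym (tabulate∘lookup u)) (trans (tabulate-cong h) (tabulate∘lookup v))

T-dichotomy : ∀ b → T b ⊎ T (not b)
T-dichotomy true = inj₁ tt
T-dichotomy false = inj₂ tt

T-dichotomy-unique : ∀ b (p q : T b ⊎ T (not b)) → p ≡ q
T-dichotomy-unique true (inj₁ tt) (inj₁ tt) = refl
T-dichotomy-unique false (inj₂ tt) (inj₂ tt) = refl

T-not⇒¬T : ∀ {b} → T (not b) → ¬ T b
T-not⇒¬T {true} ()

¬T⇒T-not : ∀ {b} → ¬ T b → T (not b)
¬T⇒T-not {true} h = h tt
¬T⇒T-not {false} h = tt

T-ext : ∀ {a b} → (T a → T b) → (T b → T a) → a ≡ b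
T-ext {true} {true} f g = refl
T-ext {true} {false} f g = ⊥-elim (f tt)
T-ext {false} {true} f g = ⊥-elim (g tt)
T-ext {false} {false} f g = refl

T-∨-exclusive : ∀ {x y} → ¬ (T x × T y) → T (x ∨ y) ↔ (T x ⊎ T y)
T-∨-exclusive {true} {true} not-both = ⊥-elim (not-both (tt , tt))
T-∨-exclusive {true} {false} _ = ⊎-absorbʳ (λ ())
T-∨-exclusive {false} _ = ⊎-absorbˡ (λ ())

exclusive-or-not : ∀ {x y} → (T x → ¬ T y) → (x ∨ y) ∧ not y ≡ x
exclusive-or-not {true} {true} h = ⊥-elim (h tt tt)
exclusive-or-not {true} {false} _ = refl
exclusive-or-not {false} {true} _ = refl
exclusive-or-not {false} {false} _ = refl

or-and-absorb : ∀ y x → (y ∨ x) ∧ x ≡ x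
or-and-absorb true true = refl
or-and-absorb true false = refl
or-and-absorb false x = ∧-idem x

and-not-or-and : ∀ n t → (n ∧ not t) ∨ (n ∧ t) ≡ n
and-not-or-and true true = refl
and-not-or-and true false = refl
and-not-or-and false t = refl

and-subsumed : ∀ {n t} → (T t → T n) → n ∧ t ≡ t
and-subsumed {true} _ = refl
and-subsumed {false} {true} h = ⊥-elim (h tt)
and-subsumed {false} {false} _ = refl

∈⇒T : ∀ {n} {S : Subset n} {i} → i ∈ₛ S → T (lookup S i)
∈⇒T p = Equivalence.from T-≡ ([]=⇒lookup p)

T⇒∈ : ∀ {n} {S : Subset n} {i} → T (lookup S i) → i ∈ₛ S
T⇒∈ {S = S} {i} t = lookup⇒[]= i S (Equivalence.to T-≡ t)

members : ∀ {n} (S : Subset n) → Fin ∣ S ∣ ↔ Σ (Fin n) (λ i → T (lookup S i))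
members [] = mk↔ₛ′ (λ ()) (λ { (() , _) }) (λ { (() , _) }) (λ ())
members (true ∷ S) = +↔⊎ {1} ⟨↔⟩ (1↔⊤ ⊎-↔ members S) ⟨↔⟩ ↔-sym Σ-Fin-suc
members (false ∷ S) = members S ⟨↔⟩ ⊎-absorbˡ (λ ()) ⟨↔⟩ ↔-sym Σ-Fin-suc

members-tabulate : ∀ {n} (f : Fin n → Bool) → Fin ∣ tabulate f ∣ ↔ Σ (Fin n) (T ∘ f)
members-tabulate f = members (tabulate f) ⟨↔⟩ Σ-fibres (λ i → ≡⇒↔ (cong T (lookup∘tabulate f i)))

opaque
  complement-count : ∀ {n} (f : Fin n → Bool) c → Σ (Fin n) (T ∘ f) ↔ Fin c →
                     Σ (Fin n) (λ i → T (not (f i))) ↔ Fin (n ∸ c)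
  complement-count {n} f c count-f =
    subst (λ x → Σ (Fin n) (λ i → T (not (f i))) ↔ Fin x) size-not-f (↔-sym (members-tabulate (not ∘ f)))
    where
    x : ℕ
    x = ∣ tabulate (not ∘ f) ∣
    split : Fin n ↔ Fin (c + x)
    split = mk↔ₛ′ (λ i → i , T-dichotomy (f i)) proj₁
              (λ { (i , p) → cong (i ,_) (T-dichotomy-unique (f i) _ p) }) (λ _ → refl)
            ⟨↔⟩ Σ-distribˡ-⊎ ⟨↔⟩ (count-f ⊎-↔ ↔-sym (members-tabulate (not ∘ f))) ⟨↔⟩ ↔-sym +↔⊎
    size-not-f : x ≡ n ∸ c
    size-not-f = trans (sym (m+n∸m≡n c x)) (cong (_∸ c) (sym (↔⇒≡ split)))

module SubsetTransport {L n : ℕ} (ι : Fin L ↔ Fin n) where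

  transport : Subset L ↔ Subset n
  transport = mk↔ₛ′ (λ S → tabulate (lookup S ∘ from)) (λ S' → tabulate (lookup S' ∘ to))
    (λ S' → vec-ext λ i → trans (lookup∘tabulate _ i)
                (trans (lookup∘tabulate _ (from i)) (cong (lookup S') (Inverse.strictlyInverseˡ ι i))))
    (λ S → vec-ext λ e → trans (lookup∘tabulate _ e)
                (trans (lookup∘tabulate _ (to e)) (cong (lookup S) (Inverse.strictlyInverseʳ ι e))))
    where open Inverse ι using (to; from)

  transport-lookup : ∀ S i → lookup (Inverse.to transport S) i ≡ lookup S (Inverse.from ι i)
  transport-lookup S i = lookup∘tabulate _ i

  transport-size : ∀ S → ∣ Inverse.to transport S ∣ ≡ ∣ S ∣
  transport-size S = ↔⇒≡ (members (Inverse.to transport S)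
    ⟨↔⟩ Σ-fibres (λ i → ≡⇒↔ (cong T (transport-lookup S i)))
    ⟨↔⟩ Σ-reindex (↔-sym ι) ⟨↔⟩ ↔-sym (members S))

_⊆ᵇ_ : ∀ {n} → Subset n → Subset n → Bool
[] ⊆ᵇ [] = true
(s ∷ S) ⊆ᵇ (x ∷ N) = (not s ∨ x) ∧ (S ⊆ᵇ N)

⊆ᵇ-sound : ∀ {n} (S N : Subset n) → T (S ⊆ᵇ N) → ∀ i → T (lookup S i) → T (lookup N i)
⊆ᵇ-sound (true ∷ S) (true ∷ N) s zero _ = tt
⊆ᵇ-sound (true ∷ S) (true ∷ N) s (suc i) u = ⊆ᵇ-sound S N s i u
⊆ᵇ-sound (false ∷ S) (x ∷ N) s (suc i) u = ⊆ᵇ-sound S N s i u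

⊆ᵇ-complete : ∀ {n} (S N : Subset n) → (∀ i → T (lookup S i) → T (lookup N i)) → T (S ⊆ᵇ N)
⊆ᵇ-complete [] [] h = tt
⊆ᵇ-complete (true ∷ S) (true ∷ N) h = ⊆ᵇ-complete S N (λ i → h (suc i))
⊆ᵇ-complete (true ∷ S) (false ∷ N) h = h zero tt
⊆ᵇ-complete (false ∷ S) (true ∷ N) h = ⊆ᵇ-complete S N (λ i → h (suc i))
⊆ᵇ-complete (false ∷ S) (false ∷ N) h = ⊆ᵇ-complete S N (λ i → h (suc i))

subsets-of : ∀ {n} (N : Subset n) → Σ (Subset n) (λ S → T (S ⊆ᵇ N)) ↔ Fin (2 ^ ∣ N ∣)
subsets-of [] = mk↔ₛ′ (λ _ → zero) (λ _ → [] , tt) (λ { zero → refl }) (λ { ([] , tt) → refl })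
subsets-of (true ∷ N) =
  ↔-sym Σ-Vec-suc ⟨↔⟩ ∃∃↔∃∃ _ ⟨↔⟩ Σ-Bool ⟨↔⟩ (subsets-of N ⊎-↔ subsets-of N) ⟨↔⟩ ↔-sym +↔⊎ ⟨↔⟩
  ≡⇒↔ (cong (λ k → Fin (2 ^ ∣ N ∣ + k)) (sym (+-identityʳ (2 ^ ∣ N ∣))))
subsets-of (false ∷ N) =
  ↔-sym Σ-Vec-suc ⟨↔⟩ ∃∃↔∃∃ _ ⟨↔⟩ Σ-Bool ⟨↔⟩ ↔-sym (⊎-absorbʳ proj₂) ⟨↔⟩ subsets-of N

-- Injective maps Fin n → Fin k, as vectors of values.  The decision procedure is
-- literally the one of Defs.isPerm?, so for n = k = d the two coincide.
Injective : ∀ {n k} → Vec (Fin k) n → Set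
Injective v = ∀ i j → lookup v i ≡ lookup v j → i ≡ j

injective? : ∀ {n k} (v : Vec (Fin k) n) → Dec (Injective v)
injective? v = all? (λ i → all? (λ j → (lookup v i ≟ᶠ lookup v j) →-dec (i ≟ᶠ j)))

Injections : ℕ → ℕ → Set
Injections n k = Σ (Vec (Fin k) n) (λ v → True (injective? v))

falling : ℕ → ℕ → ℕ
falling k zero = 1
falling zero (suc n) = 0
falling (suc k) (suc n) = suc k * falling k n

falling-diagonal : ∀ r → falling r r ≡ r !
falling-diagonal zero = refl
falling-diagonal (suc r) = cong (suc r *_) (falling-diagonal r)

-- An injection Fin (1+n) → Fin (1+k) is its first value x together with an
-- injection Fin n → Fin k: the remaining values avoid x, and punching x out of
-- Fin (1+k) identifies them with values in Fin k.
module FirstValue {n k : ℕ} where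

  avoids-head : ∀ {x : Fin (suc k)} {v : Vec (Fin (suc k)) n} → Injective (x ∷ v) → ∀ i → x ≢ lookup v i
  avoids-head inj i e with inj zero (suc i) e
  ... | ()

  punch-out : (x : Fin (suc k)) (v : Vec (Fin (suc k)) n) → (∀ i → x ≢ lookup v i) → Vec (Fin k) n
  punch-out x v avoid = tabulate (λ i → punchOut (avoid i))

  punch-in : Fin (suc k) → Vec (Fin k) n → Vec (Fin (suc k)) (suc n)
  punch-in x w = x ∷ vmap (punchIn x) w

  punch-out-injective : ∀ x v avoid → Injective (x ∷ v) → Injective (punch-out x v avoid)
  punch-out-injective x v avoid inj i j e = suc-injective (inj (suc i) (suc j)
    (punchOut-injective (avoid i) (avoid j) (trans (sym (lookup∘tabulate _ i)) (trans e (lookup∘tabulate _ j)))))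

  punch-in-injective : ∀ x w → Injective w → Injective (punch-in x w)
  punch-in-injective x w inj zero zero e = refl
  punch-in-injective x w inj zero (suc j) e = ⊥-elim (punchInᵢ≢i x (lookup w j) (sym (trans e (lookup-map j (punchIn x) w))))
  punch-in-injective x w inj (suc i) zero e = ⊥-elim (punchInᵢ≢i x (lookup w i) (trans (sym (lookup-map i (punchIn x) w)) e))
  punch-in-injective x w inj (suc i) (suc j) e = cong suc (inj i j (punchIn-injective x _ _
    (trans (sym (lookup-map i (punchIn x) w)) (trans e (lookup-map j (punchIn x) w)))))

  punchOut-of-punchIn : ∀ {x j : Fin (suc k)} (x≢j : x ≢ j) {y} → j ≡ punchIn x y → punchOut x≢j ≡ y
  punchOut-of-punchIn {x} x≢j refl = trans (punchOut-cong x refl) (punchOut-punchIn x)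

  split-first : Injections (suc n) (suc k) ↔ (Fin (suc k) × Injections n k)
  split-first = mk↔ₛ′ split join split∘join join∘split
    where
    split : Injections (suc n) (suc k) → Fin (suc k) × Injections n k
    split (x ∷ v , p) = x , punch-out x v (avoids-head (toWitness p)) ,
                        fromWitness (punch-out-injective x v _ (toWitness p))
    join : Fin (suc k) × Injections n k → Injections (suc n) (suc k)
    join (x , w , q) = punch-in x w , fromWitness (punch-in-injective x w (toWitness q))
    split∘join : ∀ y → split (join y) ≡ y
    split∘join (x , w , q) = cong (x ,_) (Σ-≡ (λ _ → T-irrelevant) (vec-ext λ i →
      trans (lookup∘tabulate _ i) (punchOut-of-punchIn _ (lookup-map i (punchIn x) w))))
    join∘split : ∀ y → join (split y) ≡ y
    join∘split (x ∷ v , p) = Σ-≡ (λ _ → T-irrelevant) (cong (x ∷_) (vec-ext λ i →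
      trans (lookup-map i (punchIn x) (punch-out x v avoid))
            (trans (cong (punchIn x) (lookup∘tabulate _ i)) (punchIn-punchOut (avoid i)))))
      where avoid = avoids-head (toWitness p)

injections-count : ∀ n k → Injections n k ↔ Fin (falling k n)
injections-count zero k = mk↔ₛ′ (λ _ → zero) (λ _ → [] , fromWitness {a? = injective? {0} {k} []} (λ ()))
  (λ { zero → refl }) (λ { ([] , p) → Σ-≡ (λ _ → T-irrelevant) refl })
injections-count (suc n) zero = mk↔ₛ′ (λ { (() ∷ _ , _) }) (λ ()) (λ ()) (λ { (() ∷ _ , _) })
injections-count (suc n) (suc k) = FirstValue.split-first ⟨↔⟩ (↔-refl ×-↔ injections-count n k) ⟨↔⟩ ↔-sym *↔×

SizedMatching : ∀ {d} (G : Graph d) (m : ℕ) → Subset (length G) → Set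
SizedMatching G m S = True (isMatching? G S ×-dec (∣ S ∣ ≟ℕ m))

matchings-count : ∀ {d} (G : Graph d) (m : ℕ) → Fin (a G m) ↔ Σ (Subset (length G)) (SizedMatching G m)
matchings-count G m = Fin-length _ ⟨↔⟩ Any-filter _ (allSubsets (length G)) ⟨↔⟩ Any-allSubsets (length G) ⟨↔⟩
  Σ-fibres (λ _ → mk↔ₛ′ proj₁ (_, _) (λ _ → refl) (λ _ → refl))

rhs-count : ∀ d m → Fin (sum (map (λ σ → a (Gσ σ) m) (Sym d))) ↔
            Σ (Vec (Fin d) d) (λ σ → True (injective? σ) × Σ (Subset (length (Gσ σ))) (SizedMatching (Gσ σ) m))
rhs-count d m = Fin-sum _ _ ⟨↔⟩ Any-filter _ (allVecs d d) ⟨↔⟩ Any-allVecs d d ⟨↔⟩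
  Σ-fibres (λ σ → ↔-refl ×-↔ matchings-count (Gσ σ) m)

lhs-count : ∀ d m → Fin (2 ^ m * (d ∸ m) ! * a (K d) m) ↔
            ((Fin (2 ^ m) × Fin ((d ∸ m) !)) × Σ (Subset (length (K d))) (SizedMatching (K d) m))
lhs-count d m = *↔× ⟨↔⟩ (*↔× ×-↔ matchings-count (K d) m)

someᵇ : ∀ {n} → (Fin n → Bool) → Bool
someᵇ f = isYes (any? (T? ∘ f))

someᵇ-intro : ∀ {n} (f : Fin n → Bool) j → T (f j) → T (someᵇ f)
someᵇ-intro f j t = fromWitness {a? = any? (T? ∘ f)} (j , t)

someᵇ-elim : ∀ {n} (f : Fin n → Bool) → T (someᵇ f) → Σ (Fin n) (T ∘ f)
someᵇ-elim f = toWitness {a? = any? (T? ∘ f)}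

someᵇ-unique : ∀ {n} (f : Fin n → Bool) → (∀ j j' → T (f j) → T (f j') → j ≡ j') →
               T (someᵇ f) ↔ Σ (Fin n) (T ∘ f)
someᵇ-unique f unique = mk↔ₛ′ (someᵇ-elim f) (λ (j , t) → someᵇ-intro f j t)
  (λ (j , t) → Σ-≡ (λ _ → T-irrelevant) (unique _ j (proj₂ (someᵇ-elim f (someᵇ-intro f j t))) t))
  (λ _ → T-irrelevant _ _)

-- A relation on Fin d, given by its Boolean adjacency matrix; rel R i j says
-- that i → j is an arc of R.
Rel : ℕ → Set
Rel d = Vec (Vec Bool d) d

rel : ∀ {d} → Rel d → Fin d → Fin d → Bool
rel R i j = lookup (lookup R i) j

dom : ∀ {d} → Rel d → Fin d → Bool
dom R i = someᵇ (rel R i)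

img : ∀ {d} → Rel d → Fin d → Bool
img R j = someᵇ (λ i → rel R i j)

Functional : ∀ {d} → Rel d → Set
Functional R = ∀ i j j' → T (rel R i j) → T (rel R i j') → j ≡ j'

Cofunctional : ∀ {d} → Rel d → Set
Cofunctional R = ∀ i i' j → T (rel R i j) → T (rel R i' j) → i ≡ i'

Extends : ∀ {d} → Vec (Fin d) d → Rel d → Set
Extends σ R = ∀ i j → T (rel R i j) → lookup σ i ≡ j

extends? : ∀ {d} (σ : Vec (Fin d) d) (R : Rel d) → Dec (Extends σ R)
extends? σ R = all? (λ i → all? (λ j → T? (rel R i j) →-dec (lookup σ i ≟ᶠ j)))

Extensions : ∀ {d} → Rel d → Set
Extensions {d} R = Σ (Vec (Fin d) d) (λ σ → True (injective? σ) × True (extends? σ R))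

-- A partial injection with m arcs has exactly (d ∸ m)! extensions to a
-- permutation: an extension is determined by its restriction to the d ∸ m
-- vertices outside the domain, which is an arbitrary bijection onto the d ∸ m
-- vertices outside the image.
module Extension-count {d m : ℕ} (R : Rel d) (functional : Functional R) (cofunctional : Cofunctional R)
                       (size : ∣ tabulate (dom R) ∣ ≡ m) where

  r : ℕ
  r = d ∸ m

  -- The domain has m vertices, and so has the image, since arcs are counted
  -- both by their tails and by their heads.
  dom-count : Σ (Fin d) (T ∘ dom R) ↔ Fin m
  dom-count = subst (λ x → Σ (Fin d) (T ∘ dom R) ↔ Fin x) size (↔-sym (members-tabulate (dom R)))

  img-count : Σ (Fin d) (T ∘ img R) ↔ Fin m
  img-count = Σ-fibres (λ j → someᵇ-unique (λ i → rel R i j) (λ i i' → cofunctional i i' j)) ⟨↔⟩ ∃∃↔∃∃ _ ⟨↔⟩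
              Σ-fibres (λ i → ↔-sym (someᵇ-unique (rel R i) (functional i))) ⟨↔⟩ dom-count

  Free : Set
  Free = Σ (Fin d) (λ i → T (not (dom R i)))

  Unhit : Set
  Unhit = Σ (Fin d) (λ j → T (not (img R j)))

  free-count : Free ↔ Fin r
  free-count = complement-count (dom R) m dom-count

  unhit-count : Unhit ↔ Fin r
  unhit-count = complement-count (img R) m img-count

  open Inverse free-count using () renaming (to to free→; from to →free; strictlyInverseˡ to free-inverseˡ; strictlyInverseʳ to free-inverseʳ)
  open Inverse unhit-count using () renaming (to to unhit→; from to →unhit; strictlyInverseˡ to unhit-inverseˡ; strictlyInverseʳ to unhit-inverseʳ)

  free↦unhit : ∀ σ → Injective σ → Extends σ R → ∀ i → T (not (dom R i)) → T (not (img R (lookup σ i)))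
  free↦unhit σ inj ext i free = ¬T⇒T-not λ hit →
    let (i' , i'→σi) = someᵇ-elim _ hit
        i'≡i = inj i' i (ext i' (lookup σ i) i'→σi)
    in T-not⇒¬T free (someᵇ-intro _ (lookup σ i) (subst (λ k → T (rel R k (lookup σ i))) i'≡i i'→σi))

  restrict : ∀ σ → Injective σ → Extends σ R → Vec (Fin r) r
  restrict σ inj ext = tabulate λ a →
    let (i , free) = →free a in unhit→ (lookup σ i , free↦unhit σ inj ext i free)

  free-value : Vec (Fin r) r → Free → Fin d
  free-value π x = proj₁ (→unhit (lookup π (free→ x)))

  extend-by : Vec (Fin r) r → ∀ i → T (dom R i) ⊎ T (not (dom R i)) → Fin d
  extend-by π i (inj₁ t) = proj₁ (someᵇ-elim (rel R i) t)
  extend-by π i (inj₂ t) = free-value π (i , t)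

  extend-at : Vec (Fin r) r → Fin d → Fin d
  extend-at π i = extend-by π i (T-dichotomy (dom R i))

  extend-at-dom : ∀ π i (t : T (dom R i)) → T (rel R i (extend-at π i))
  extend-at-dom π i t = subst (T ∘ rel R i) (cong (extend-by π i) (T-dichotomy-unique (dom R i) (inj₁ t) (T-dichotomy (dom R i))))
                              (proj₂ (someᵇ-elim (rel R i) t))

  extend-at-free : ∀ π i (t : T (not (dom R i))) → extend-at π i ≡ free-value π (i , t)
  extend-at-free π i t = cong (extend-by π i) (T-dichotomy-unique (dom R i) (T-dichotomy (dom R i)) (inj₂ t))

  extend : Vec (Fin r) r → Vec (Fin d) d
  extend π = tabulate (extend-at π)

  -- extend π is injective: domain values are separated by co-functionality, free
  -- values by injectivity of π, and a domain value is hit while a free value is not.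
  free-value-injective : ∀ π → Injective π → ∀ {x y} → free-value π x ≡ free-value π y → x ≡ y
  free-value-injective π inj e =
    ↔-to-injective free-count (inj _ _ (↔-from-injective unhit-count (Σ-≡ (λ _ → T-irrelevant) e)))

  extend-at-dom-hit : ∀ π i → T (dom R i) → T (img R (extend-at π i))
  extend-at-dom-hit π i t = someᵇ-intro _ i (extend-at-dom π i t)

  extend-at-free-unhit : ∀ π i (t : T (not (dom R i))) → T (not (img R (extend-at π i)))
  extend-at-free-unhit π i t =
    subst (λ j → T (not (img R j))) (sym (extend-at-free π i t)) (proj₂ (→unhit (lookup π (free→ (i , t)))))

  extend-at-injective : ∀ π → Injective π → ∀ i i' → extend-at π i ≡ extend-at π i' → i ≡ i'
  extend-at-injective π inj i i' e = by-cases (T-dichotomy (dom R i)) (T-dichotomy (dom R i'))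
    where
    by-cases : T (dom R i) ⊎ T (not (dom R i)) → T (dom R i') ⊎ T (not (dom R i')) → i ≡ i'
    by-cases (inj₁ t) (inj₁ t') =
      cofunctional i i' _ (subst (λ j → T (rel R i j)) e (extend-at-dom π i t)) (extend-at-dom π i' t')
    by-cases (inj₁ t) (inj₂ t') =
      ⊥-elim (T-not⇒¬T (extend-at-free-unhit π i' t') (subst (T ∘ img R) e (extend-at-dom-hit π i t)))
    by-cases (inj₂ t) (inj₁ t') =
      ⊥-elim (T-not⇒¬T (extend-at-free-unhit π i t) (subst (T ∘ img R) (sym e) (extend-at-dom-hit π i' t')))
    by-cases (inj₂ t) (inj₂ t') =
      cong proj₁ (free-value-injective π inj (trans (sym (extend-at-free π i t)) (trans e (extend-at-free π i' t'))))

  extend-injective : ∀ π → Injective π → Injective (extend π)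
  extend-injective π inj i i' e =
    extend-at-injective π inj i i' (trans (sym (lookup∘tabulate _ i)) (trans e (lookup∘tabulate _ i')))

  -- extend π extends R because R is functional.
  extend-extends : ∀ π → Extends (extend π) R
  extend-extends π i j t = trans (lookup∘tabulate _ i)
    (functional i _ j (extend-at-dom π i (someᵇ-intro (rel R i) j t)) t)

  restrict-injective : ∀ σ (inj : Injective σ) (ext : Extends σ R) → Injective (restrict σ inj ext)
  restrict-injective σ inj ext a a' e = ↔-from-injective free-count (Σ-≡ (λ _ → T-irrelevant)
    (inj _ _ (cong proj₁ (↔-to-injective unhit-count
      (trans (sym (lookup∘tabulate _ a)) (trans e (lookup∘tabulate _ a')))))))

  -- extend undoes restrict: on the domain both agree with R, off it by construction.
  extend-restrict : ∀ σ (inj : Injective σ) (ext : Extends σ R) → extend (restrict σ inj ext) ≡ σ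
  extend-restrict σ inj ext = vec-ext λ i → trans (lookup∘tabulate _ i) (by-cases i (T-dichotomy (dom R i)))
    where
    π = restrict σ inj ext
    by-cases : ∀ i → T (dom R i) ⊎ T (not (dom R i)) → extend-at π i ≡ lookup σ i
    by-cases i (inj₁ t) = sym (ext i _ (extend-at-dom π i t))
    by-cases i (inj₂ t) = trans (extend-at-free π i t) (trans
      (cong (proj₁ ∘ →unhit) (lookup∘tabulate _ (free→ (i , t))))
      (trans (cong proj₁ (unhit-inverseʳ _)) (cong (lookup σ ∘ proj₁) (free-inverseʳ (i , t)))))

  -- restrict undoes extend, since extend follows π on the free vertices.
  restrict-extend : ∀ π (inj : Injective π) → restrict (extend π) (extend-injective π inj) (extend-extends π) ≡ π
  restrict-extend π inj = vec-ext λ a →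
    let (i , t) = →free a
    in trans (lookup∘tabulate _ a)
       (trans (cong unhit→ (Σ-≡ (λ _ → T-irrelevant) {b' = proj₂ (→unhit (lookup π a))}
          (trans (lookup∘tabulate _ i)
          (trans (extend-at-free π i t) (cong (λ z → proj₁ (→unhit (lookup π z))) (free-inverseˡ a))))))
       (unhit-inverseˡ (lookup π a)))

  extensions↔permutations : Extensions R ↔ Injections r r
  extensions↔permutations = mk↔ₛ′
    (λ (σ , p , q) → restrict σ (toWitness p) (toWitness q) , fromWitness (restrict-injective σ (toWitness p) (toWitness q)))
    (λ (π , p) → extend π , fromWitness (extend-injective π (toWitness p)) , fromWitness (extend-extends π))
    (λ (π , p) → Σ-≡ (λ _ → T-irrelevant) (restrict-extend π (toWitness p)))
    (λ (σ , p , q) → Σ-≡ (λ _ (p , q) (p' , q') → cong₂ _,_ (T-irrelevant p p') (T-irrelevant q q')) (extend-restrict σ (toWitness p) (toWitness q)))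

  extensions-count : Extensions R ↔ Fin (r !)
  extensions-count = extensions↔permutations ⟨↔⟩ injections-count r r ⟨↔⟩ ≡⇒↔ (cong Fin (falling-diagonal r))

record Labelling {C : Set} (xs : List C) (A : Set) (f : A → C) : Set where
  field
    label : Fin (length xs) ↔ A
    entry : ∀ e → List.lookup xs e ≡ f (Inverse.to label e)

positions : ∀ {C : Set} (xs : List C) → Fin (length xs) ↔ Σ C (λ c → Any (c ≡_) xs)
positions [] = mk↔ₛ′ (λ ()) (λ { (_ , ()) }) (λ { (_ , ()) }) (λ ())
positions (x ∷ xs) = mk↔ₛ′ to from to∘from from∘to
  where
  to : Fin (length (x ∷ xs)) → Σ _ (λ c → Any (c ≡_) (x ∷ xs))
  to zero = x , here refl
  to (suc e) = let (c , p) = Inverse.to (positions xs) e in c , there p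
  from : Σ _ (λ c → Any (c ≡_) (x ∷ xs)) → Fin (length (x ∷ xs))
  from (c , here _) = zero
  from (c , there p) = suc (Inverse.from (positions xs) (c , p))
  to∘from : ∀ y → to (from y) ≡ y
  to∘from (c , here refl) = refl
  to∘from (c , there p) = cong (λ (c , p) → c , there p) (Inverse.strictlyInverseˡ (positions xs) (c , p))
  from∘to : ∀ y → from (to y) ≡ y
  from∘to zero = refl
  from∘to (suc e) = cong suc (Inverse.strictlyInverseʳ (positions xs) e)

positions-entry : ∀ {C : Set} (xs : List C) e → proj₁ (Inverse.to (positions xs) e) ≡ List.lookup xs e
positions-entry (x ∷ xs) zero = refl
positions-entry (x ∷ xs) (suc e) = positions-entry xs e

-- A list is labelled by A via f as soon as each c occurs in it once for each a with c ≡ f a.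
-- (Opaque: a labelling is only ever used through its two fields.)
opaque
  labelling : ∀ {C A : Set} (xs : List C) (f : A → C) → (∀ c → Any (c ≡_) xs ↔ Σ A (λ a → c ≡ f a)) → Labelling xs A f
  labelling {C} {A} xs f occurrences = record
    { label = positions xs ⟨↔⟩ Σ-fibres occurrences ⟨↔⟩ fibres
    ; entry = λ e → trans (sym (positions-entry xs e)) (proj₂ (Inverse.to (occurrences _) (proj₂ (Inverse.to (positions xs) e))))
    }
    where
    fibres : Σ C (λ c → Σ A (λ a → c ≡ f a)) ↔ A
    fibres = mk↔ₛ′ (λ (c , a , e) → a) (λ a → f a , a , refl) (λ _ → refl) (λ { (c , a , refl) → refl })

arc : ∀ {d} → Vec (Fin d) d → Fin d → Fin d × Fin d
arc σ s = s , lookup σ s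

Gσ-labelling : ∀ {d} (σ : Vec (Fin d) d) → Labelling (Gσ σ) (Fin d) (arc σ)
Gσ-labelling {d} σ = labelling (Gσ σ) _ (λ c → ↔-sym map↔ ⟨↔⟩ Any-tabulate d id)

Pair< : ℕ → Set
Pair< d = Σ (Fin d) (λ i → Σ (Fin d) (λ j → True (toℕ i <? toℕ j)))

Pair<-≡ : ∀ {d} {p q : Pair< d} → proj₁ p ≡ proj₁ q → proj₁ (proj₂ p) ≡ proj₁ (proj₂ q) → p ≡ q
Pair<-≡ {p = i , j , t} {.i , .j , t'} refl refl = cong (λ t → i , j , t) (T-irrelevant t t')

pair-ends : ∀ {d} → Pair< d → Fin d × Fin d
pair-ends (i , j , _) = i , j

K-labelling : ∀ d → Labelling (K d) (Pair< d) pair-ends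
K-labelling d = labelling (K d) pair-ends λ c →
  Any-concatMap _ (allFin d) ⟨↔⟩ Any-tabulate d id ⟨↔⟩
  Σ-fibres (λ i → ↔-sym map↔ ⟨↔⟩ Any-filter (λ j → toℕ i <? toℕ j) (allFin d) ⟨↔⟩ Any-tabulate d id) ⟨↔⟩
  mk↔ₛ′ (λ (i , j , t , e) → (i , j , t) , e) (λ ((i , j , t) , e) → i , j , t , e) (λ _ → refl) (λ _ → refl)

LabelledMatching : ∀ {d n} → (Fin n → Fin d × Fin d) → ℕ → Subset n → Set
LabelledMatching f m S =
  (∀ i → T (lookup S i) → proj₁ (f i) ≢ proj₂ (f i)) ×
  (∀ i j → T (lookup S i) → T (lookup S j) → i ≢ j → NoCommonEndpoint (f i) (f j)) ×
  ∣ S ∣ ≡ m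

labelledMatching? : ∀ {d n} (f : Fin n → Fin d × Fin d) m (S : Subset n) → Dec (LabelledMatching f m S)
labelledMatching? f m S =
  all? (λ i → T? (lookup S i) →-dec ¬? (proj₁ (f i) ≟ᶠ proj₂ (f i))) ×-dec
  all? (λ i → all? (λ j → T? (lookup S i) →-dec (T? (lookup S j) →-dec (¬? (i ≟ᶠ j) →-dec noCommon? (f i) (f j))))) ×-dec
  (∣ S ∣ ≟ℕ m)

module _ {d n : ℕ} {G : Graph d} {f : Fin n → Fin d × Fin d} (lab : Labelling G (Fin n) f) (m : ℕ) where

  open Labelling lab
  open SubsetTransport label

  private
    ends-label : ∀ i → ends G (Inverse.from label i) ≡ f i
    ends-label i = trans (entry _) (cong f (Inverse.strictlyInverseˡ label i))

    in-transport : ∀ S e → e ∈ₛ S → T (lookup (Inverse.to transport S) (Inverse.to label e))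
    in-transport S e p = subst T (sym (trans (transport-lookup S _) (cong (lookup S) (Inverse.strictlyInverseʳ label e)))) (∈⇒T p)

    from-transport : ∀ S i → T (lookup (Inverse.to transport S) i) → Inverse.from label i ∈ₛ S
    from-transport S i t = T⇒∈ (subst T (transport-lookup S i) t)

    to-labelled : ∀ S → IsMatching G S × ∣ S ∣ ≡ m → LabelledMatching f m (Inverse.to transport S)
    to-labelled S ((loop-free , disjoint) , size) = no-loop , no-common , trans (transport-size S) size
      where
      no-loop : ∀ i → T (lookup (Inverse.to transport S) i) → proj₁ (f i) ≢ proj₂ (f i)
      no-loop i t e = loop-free _ (from-transport S i t)
        (trans (cong proj₁ (ends-label i)) (trans e (sym (cong proj₂ (ends-label i)))))
      no-common : ∀ i j → T (lookup (Inverse.to transport S) i) → T (lookup (Inverse.to transport S) j) → i ≢ j →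
                  NoCommonEndpoint (f i) (f j)
      no-common i j ti tj i≢j = subst₂ NoCommonEndpoint (ends-label i) (ends-label j)
        (disjoint _ _ (from-transport S i ti) (from-transport S j tj) (i≢j ∘ ↔-from-injective label))

    from-labelled : ∀ S → LabelledMatching f m (Inverse.to transport S) → IsMatching G S × ∣ S ∣ ≡ m
    from-labelled S (no-loop , no-common , size) = (loop-free , disjoint) , trans (sym (transport-size S)) size
      where
      loop-free : ∀ e → e ∈ₛ S → ¬ IsLoop G e
      loop-free e p loop = no-loop _ (in-transport S e p)
        (trans (sym (cong proj₁ (entry e))) (trans loop (cong proj₂ (entry e))))
      disjoint : ∀ e e' → e ∈ₛ S → e' ∈ₛ S → e ≢ e' → NoCommonEndpoint (ends G e) (ends G e')
      disjoint e e' p p' e≢e' = subst₂ NoCommonEndpoint (sym (entry e)) (sym (entry e'))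
        (no-common _ _ (in-transport S e p) (in-transport S e' p') (e≢e' ∘ ↔-to-injective label))

  matchings↔labelled : Σ (Subset (length G)) (SizedMatching G m) ↔ Σ (Subset n) (λ S → True (labelledMatching? f m S))
  matchings↔labelled = Σ-fibres (λ S → True-↔ _ _ (to-labelled S) (from-labelled S)) ⟨↔⟩ Σ-reindex transport

-- No arc of R ends where an arc of R starts.  For a partial injection this says
-- that its arcs, read as edges, form a matching (in particular there are no
-- loops and no 2-cycles).
NoTwoStep : ∀ {d} → Rel d → Set
NoTwoStep R = ∀ i j k → T (rel R i j) → ¬ T (rel R j k)

OrientedMatching : ∀ {d} → ℕ → Rel d → Set
OrientedMatching m R = Functional R × Cofunctional R × NoTwoStep R × ∣ tabulate (dom R) ∣ ≡ m

orientedMatching? : ∀ {d} m (R : Rel d) → Dec (OrientedMatching m R)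
orientedMatching? m R =
  all? (λ i → all? (λ j → all? (λ j' → T? (rel R i j) →-dec (T? (rel R i j') →-dec (j ≟ᶠ j'))))) ×-dec
  all? (λ i → all? (λ i' → all? (λ j → T? (rel R i j) →-dec (T? (rel R i' j) →-dec (i ≟ᶠ i'))))) ×-dec
  all? (λ i → all? (λ j → all? (λ k → T? (rel R i j) →-dec ¬? (T? (rel R j k))))) ×-dec
  (∣ tabulate (dom R) ∣ ≟ℕ m)

OrientedMatchings : ℕ → ℕ → Set
OrientedMatchings d m = Σ (Rel d) (λ R → True (orientedMatching? m R))

-- A permutation with an m-matching of G_σ (read on tails) is the same as an
-- oriented m-matching together with a permutation extending it: the matching
-- is the restriction of σ to its tails.
module PermutationWithMatching {d m : ℕ} where

  Pairs : Set
  Pairs = Σ (Vec (Fin d) d) (λ σ → True (injective? σ) × Σ (Subset d) (λ S → True (labelledMatching? (arc σ) m S)))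

  restriction : Vec (Fin d) d → Subset d → Rel d
  restriction σ S = tabulate (λ i → tabulate (λ j → lookup S i ∧ ⌊ lookup σ i ≟ᶠ j ⌋))

  restriction-rel : ∀ σ S i j → rel (restriction σ S) i j ≡ lookup S i ∧ ⌊ lookup σ i ≟ᶠ j ⌋
  restriction-rel σ S i j = trans (cong (λ v → lookup v j) (lookup∘tabulate _ i)) (lookup∘tabulate _ j)

  restriction-arc : ∀ σ S i j → T (rel (restriction σ S) i j) → T (lookup S i) × lookup σ i ≡ j
  restriction-arc σ S i j t =
    let (s , e) = Equivalence.to T-∧ (subst T (restriction-rel σ S i j) t) in s , toWitness e

  arc-restriction : ∀ σ S i → T (lookup S i) → T (rel (restriction σ S) i (lookup σ i))
  arc-restriction σ S i s = subst T (sym (restriction-rel σ S i _)) (Equivalence.from T-∧ (s , fromWitness refl))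

  restriction-dom : ∀ σ S → tabulate (dom (restriction σ S)) ≡ S
  restriction-dom σ S = vec-ext λ i → trans (lookup∘tabulate _ i) (T-ext
    (λ t → let (j , a) = someᵇ-elim (rel (restriction σ S) i) t in proj₁ (restriction-arc σ S i j a))
    (λ s → someᵇ-intro (rel (restriction σ S) i) (lookup σ i) (arc-restriction σ S i s)))

  restriction-extended : ∀ σ S → Extends σ (restriction σ S)
  restriction-extended σ S i j t = proj₂ (restriction-arc σ S i j t)

  restriction-oriented : ∀ σ S → Injective σ → LabelledMatching (arc σ) m S → OrientedMatching m (restriction σ S)
  restriction-oriented σ S inj (no-loop , no-common , size) =
    functional , cofunctional , no-two-step , trans (cong ∣_∣ (restriction-dom σ S)) size
    where
    functional : Functional (restriction σ S)
    functional i j j' t t' = trans (sym (proj₂ (restriction-arc σ S i j t))) (proj₂ (restriction-arc σ S i j' t'))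
    cofunctional : Cofunctional (restriction σ S)
    cofunctional i i' j t t' = inj i i' (trans (proj₂ (restriction-arc σ S i j t)) (sym (proj₂ (restriction-arc σ S i' j t'))))
    no-two-step : NoTwoStep (restriction σ S)
    no-two-step i j k t t' with restriction-arc σ S i j t | restriction-arc σ S j k t' | i ≟ᶠ j
    ... | (si , σi≡j) | _ | yes refl = no-loop i si (sym σi≡j)
    ... | (si , σi≡j) | (sj , _) | no i≢j = proj₁ (proj₂ (proj₂ (no-common i j si sj i≢j))) σi≡j

  dom-matching : ∀ (R : Rel d) (σ : Vec (Fin d) d) → OrientedMatching m R → Injective σ → Extends σ R → LabelledMatching (arc σ) m (tabulate (dom R))
  dom-matching R σ (_ , _ , no-two-step , size) inj ext = no-loop , no-common , size
    where
    arc-at : ∀ i → T (lookup (tabulate (dom R)) i) → T (rel R i (lookup σ i))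
    arc-at i t = let (j , a) = someᵇ-elim (rel R i) (subst T (lookup∘tabulate (dom R) i) t)
                 in subst (λ k → T (rel R i k)) (sym (ext i j a)) a
    no-loop : ∀ i → T (lookup (tabulate (dom R)) i) → i ≢ lookup σ i
    no-loop i t e = let a = subst (λ k → T (rel R i k)) (sym e) (arc-at i t) in no-two-step i i i a a
    no-common : ∀ i j → T (lookup (tabulate (dom R)) i) → T (lookup (tabulate (dom R)) j) → i ≢ j →
                NoCommonEndpoint (arc σ i) (arc σ j)
    no-common i j ti tj i≢j = i≢j , tail-head , head-tail , i≢j ∘ inj i j
      where
      tail-head : i ≢ lookup σ j
      tail-head e = no-two-step j i (lookup σ i) (subst (λ k → T (rel R j k)) (sym e) (arc-at j tj)) (arc-at i ti)
      head-tail : lookup σ i ≢ j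
      head-tail e = no-two-step i j (lookup σ j) (subst (λ k → T (rel R i k)) e (arc-at i ti)) (arc-at j tj)

  restriction-of-dom : ∀ (R : Rel d) σ → Extends σ R → restriction σ (tabulate (dom R)) ≡ R
  restriction-of-dom R σ ext = vec-ext λ i → vec-ext λ j → trans (restriction-rel σ (tabulate (dom R)) i j) (T-ext
    (λ t → let (in-dom , σi≡j) = Equivalence.to T-∧ t
               (j' , a) = someᵇ-elim (rel R i) (subst T (lookup∘tabulate (dom R) i) in-dom)
           in subst (λ k → T (rel R i k)) (trans (sym (ext i j' a)) (toWitness σi≡j)) a)
    (λ a → Equivalence.from T-∧ (subst T (sym (lookup∘tabulate (dom R) i)) (someᵇ-intro (rel R i) j a) ,
                                 fromWitness (ext i j a))))

  pairs↔extended-matchings : Pairs ↔ Σ (OrientedMatchings d m) (Extensions ∘ proj₁)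
  pairs↔extended-matchings = mk↔ₛ′ to from to∘from from∘to
    where
    to : Pairs → Σ (OrientedMatchings d m) (Extensions ∘ proj₁)
    to (σ , p , S , q) = (restriction σ S , fromWitness (restriction-oriented σ S (toWitness p) (toWitness q))) ,
                         σ , p , fromWitness (restriction-extended σ S)
    from : Σ (OrientedMatchings d m) (Extensions ∘ proj₁) → Pairs
    from ((R , ok) , σ , p , e) = σ , p , tabulate (dom R) , fromWitness (dom-matching R σ (toWitness ok) (toWitness p) (toWitness e))
    to∘from : ∀ y → to (from y) ≡ y
    to∘from ((R , ok) , σ , p , e) = same (restriction-of-dom R σ (toWitness e))
      where
      same : ∀ {R'} {ok' : True (orientedMatching? m R')} {e' : True (extends? σ R')} → R' ≡ R →
             _≡_ {A = Σ (OrientedMatchings d m) (Extensions ∘ proj₁)} ((R' , ok') , σ , p , e') ((R , ok) , σ , p , e)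
      same {ok' = ok'} {e'} refl = cong₂ (λ ok e → (R , ok) , σ , p , e) (T-irrelevant ok' ok) (T-irrelevant e' e)
    from∘to : ∀ x → from (to x) ≡ x
    from∘to (σ , p , S , q) = cong (λ z → σ , p , z) (Σ-≡ (λ _ → T-irrelevant) (restriction-dom σ S))

Order : ∀ {d} → Fin d → Fin d → Set
Order i j = True (toℕ i <? toℕ j) ⊎ (True (toℕ j <? toℕ i) ⊎ i ≡ j)

compare : ∀ {d} (i j : Fin d) → Order i j
compare i j with <-cmp i j
... | tri< i<j _ _ = inj₁ (fromWitness i<j)
... | tri≈ _ i≡j _ = inj₂ (inj₂ i≡j)
... | tri> _ _ j<i = inj₂ (inj₁ (fromWitness j<i))

-- Order i j has a single element, so case analysis on compare is canonical.
Order-unique : ∀ {d} {i j : Fin d} (o o' : Order i j) → o ≡ o'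
Order-unique (inj₁ t) (inj₁ t') = cong inj₁ (T-irrelevant t t')
Order-unique (inj₁ t) (inj₂ (inj₁ t')) = ⊥-elim (<-asym (toWitness t) (toWitness t'))
Order-unique (inj₁ t) (inj₂ (inj₂ refl)) = ⊥-elim (<-irrefl refl (toWitness t))
Order-unique (inj₂ (inj₁ t)) (inj₁ t') = ⊥-elim (<-asym (toWitness t) (toWitness t'))
Order-unique (inj₂ (inj₁ t)) (inj₂ (inj₁ t')) = cong (inj₂ ∘ inj₁) (T-irrelevant t t')
Order-unique (inj₂ (inj₁ t)) (inj₂ (inj₂ refl)) = ⊥-elim (<-irrefl refl (toWitness t))
Order-unique (inj₂ (inj₂ refl)) (inj₁ t') = ⊥-elim (<-irrefl refl (toWitness t'))
Order-unique (inj₂ (inj₂ refl)) (inj₂ (inj₁ t')) = ⊥-elim (<-irrefl refl (toWitness t'))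
Order-unique (inj₂ (inj₂ p)) (inj₂ (inj₂ q)) = cong (inj₂ ∘ inj₂) (Decidable⇒UIP.≡-irrelevant _≟ᶠ_ p q)

distinct-pairs : ∀ {d} (P : Fin d → Fin d → Set) → (∀ i → ¬ P i i) →
                 (Σ (Pair< d) (λ (i , j , _) → P i j) ⊎ Σ (Pair< d) (λ (i , j , _) → P j i)) ↔
                 Σ (Fin d) (λ i → Σ (Fin d) (P i))
distinct-pairs P no-loop = mk↔ₛ′ to from to∘from from∘to
  where
  to : _ → Σ _ (λ i → Σ _ (P i))
  to (inj₁ ((i , j , _) , a)) = i , j , a
  to (inj₂ ((i , j , _) , a)) = j , i , a
  from-order : ∀ i j → P i j → Order i j → _
  from-order i j a (inj₁ t) = inj₁ ((i , j , t) , a)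
  from-order i j a (inj₂ (inj₁ t)) = inj₂ ((j , i , t) , a)
  from-order i .i a (inj₂ (inj₂ refl)) = ⊥-elim (no-loop i a)
  from : Σ _ (λ i → Σ _ (P i)) → _
  from (i , j , a) = from-order i j a (compare i j)
  to∘from : ∀ x → to (from x) ≡ x
  to∘from (i , j , a) with compare i j
  ... | inj₁ _ = refl
  ... | inj₂ (inj₁ _) = refl
  ... | inj₂ (inj₂ refl) = ⊥-elim (no-loop i a)
  from∘to : ∀ y → from (to y) ≡ y
  from∘to (inj₁ ((i , j , t) , a)) rewrite Order-unique (compare i j) (inj₁ t) = refl
  from∘to (inj₂ ((i , j , t) , a)) rewrite Order-unique (compare j i) (inj₂ (inj₁ t)) = refl

Incident : ∀ {d} (G : Graph d) → Edge G → Fin d → Set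
Incident G e v = proj₁ (ends G e) ≡ v ⊎ proj₂ (ends G e) ≡ v

Disjoint : ∀ {d} (G : Graph d) → Subset (length G) → Set
Disjoint G N = ∀ e e' → e ∈ₛ N → e' ∈ₛ N → e ≢ e' → NoCommonEndpoint (ends G e) (ends G e')

SharingCoincide : ∀ {d} (G : Graph d) → Subset (length G) → Set
SharingCoincide G N = ∀ e e' v → e ∈ₛ N → e' ∈ₛ N → Incident G e v → Incident G e' v → e ≡ e'

disjoint⇒sharing-coincide : ∀ {d} (G : Graph d) N → Disjoint G N → SharingCoincide G N
disjoint⇒sharing-coincide G N disjoint e e' v n n' at at' with e ≟ᶠ e'
... | yes e≡e' = e≡e'
... | no e≢e' with disjoint e e' n n' e≢e' | at | at'
...   | (c , _ , _ , _) | inj₁ p | inj₁ p' = ⊥-elim (c (trans p (sym p')))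
...   | (_ , c , _ , _) | inj₁ p | inj₂ p' = ⊥-elim (c (trans p (sym p')))
...   | (_ , _ , c , _) | inj₂ p | inj₁ p' = ⊥-elim (c (trans p (sym p')))
...   | (_ , _ , _ , c) | inj₂ p | inj₂ p' = ⊥-elim (c (trans p (sym p')))

sharing-coincide⇒disjoint : ∀ {d} (G : Graph d) N → SharingCoincide G N → Disjoint G N
sharing-coincide⇒disjoint G N coincide e e' n n' e≢e' =
  (λ p → e≢e' (coincide e e' _ n n' (inj₁ p) (inj₁ refl))) ,
  (λ p → e≢e' (coincide e e' _ n n' (inj₁ p) (inj₂ refl))) ,
  (λ p → e≢e' (coincide e e' _ n n' (inj₂ p) (inj₁ refl))) ,
  (λ p → e≢e' (coincide e e' _ n n' (inj₂ p) (inj₂ refl)))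

module Orientations {d : ℕ} where

  LK : ℕ
  LK = length (K d)

  open Labelling (K-labelling d)

  pair : Fin LK → Pair< d
  pair = Inverse.to label

  edge : Pair< d → Fin LK
  edge = Inverse.from label

  tail head : Fin LK → Fin d
  tail e = proj₁ (pair e)
  head e = proj₁ (proj₂ (pair e))

  ordered : ∀ e → True (toℕ (tail e) <? toℕ (head e))
  ordered e = proj₂ (proj₂ (pair e))

  ends-K : ∀ e → ends (K d) e ≡ (tail e , head e)
  ends-K e = entry e

  tail≢head : ∀ e → tail e ≢ head e
  tail≢head e p = <-irrefl (cong toℕ p) (toWitness (ordered e))

  pair-edge : ∀ p → pair (edge p) ≡ p
  pair-edge = Inverse.strictlyInverseˡ label

  tail-edge : ∀ p → tail (edge p) ≡ proj₁ p
  tail-edge p = cong proj₁ (pair-edge p)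

  head-edge : ∀ p → head (edge p) ≡ proj₁ (proj₂ p)
  head-edge p = cong (proj₁ ∘ proj₂) (pair-edge p)

  Joins : Fin LK → Fin d → Fin d → Set
  Joins e x y = (tail e ≡ x × head e ≡ y) ⊎ (tail e ≡ y × head e ≡ x)

  same-ends : ∀ {e e'} → tail e ≡ tail e' → head e ≡ head e' → e ≡ e'
  same-ends p q = ↔-to-injective label (Pair<-≡ p q)

  edge-ends : ∀ e t → edge (tail e , head e , t) ≡ e
  edge-ends e t = same-ends (tail-edge _) (head-edge _)

  crossed-ends : ∀ {e e'} → tail e ≡ head e' → head e ≡ tail e' → ⊥
  crossed-ends {e} {e'} p q =
    <-asym (toWitness (ordered e)) (subst₂ (λ x y → toℕ x < toℕ y) (sym q) (sym p) (toWitness (ordered e')))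

  joins-unique : ∀ {e e' x y} → Joins e x y → Joins e' x y → e ≡ e'
  joins-unique (inj₁ (p , q)) (inj₁ (p' , q')) = same-ends (trans p (sym p')) (trans q (sym q'))
  joins-unique (inj₁ (p , q)) (inj₂ (p' , q')) = ⊥-elim (crossed-ends (trans p (sym q')) (trans q (sym p')))
  joins-unique (inj₂ (p , q)) (inj₁ (p' , q')) = ⊥-elim (crossed-ends (trans p (sym q')) (trans q (sym p')))
  joins-unique (inj₂ (p , q)) (inj₂ (p' , q')) = same-ends (trans p (sym p')) (trans q (sym q'))

  incident-joins : ∀ e v → Incident (K d) e v → Σ (Fin d) (λ w → Joins e v w)
  incident-joins e v (inj₁ p) = head e , inj₁ (trans (cong proj₁ (sym (ends-K e))) p , refl)
  incident-joins e v (inj₂ p) = tail e , inj₂ (refl , trans (cong proj₂ (sym (ends-K e))) p)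

  support : Rel d → Subset LK
  support R = tabulate (λ e → rel R (tail e) (head e) ∨ rel R (head e) (tail e))

  reversed : Rel d → Subset LK
  reversed R = tabulate (λ e → rel R (head e) (tail e))

  support-at : ∀ R p → lookup (support R) (edge p) ≡ rel R (proj₁ p) (proj₁ (proj₂ p)) ∨ rel R (proj₁ (proj₂ p)) (proj₁ p)
  support-at R p = trans (lookup∘tabulate _ (edge p)) (cong (λ (q : Pair< d) → rel R (proj₁ q) (proj₁ (proj₂ q)) ∨ rel R (proj₁ (proj₂ q)) (proj₁ q)) (pair-edge p))

  reversed-at : ∀ R p → lookup (reversed R) (edge p) ≡ rel R (proj₁ (proj₂ p)) (proj₁ p)
  reversed-at R p = trans (lookup∘tabulate _ (edge p)) (cong (λ (i , j , _) → rel R j i) (pair-edge p))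

  orientᵇ : Subset LK → Subset LK → (i j : Fin d) → Order i j → Bool
  orientᵇ N Tt i j (inj₁ t) = lookup N (edge (i , j , t)) ∧ not (lookup Tt (edge (i , j , t)))
  orientᵇ N Tt i j (inj₂ (inj₁ t)) = lookup N (edge (j , i , t)) ∧ lookup Tt (edge (j , i , t))
  orientᵇ N Tt i j (inj₂ (inj₂ _)) = false

  orient : Subset LK → Subset LK → Rel d
  orient N Tt = tabulate λ i → tabulate λ j → orientᵇ N Tt i j (compare i j)

  rel-orient : ∀ N Tt i j (o : Order i j) → rel (orient N Tt) i j ≡ orientᵇ N Tt i j o
  rel-orient N Tt i j o = trans (cong (λ v → lookup v j) (lookup∘tabulate (λ i → tabulate λ j → orientᵇ N Tt i j (compare i j)) i))
    (trans (lookup∘tabulate (λ j → orientᵇ N Tt i j (compare i j)) j) (cong (orientᵇ N Tt i j) (Order-unique (compare i j) o)))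

  support↔arcs : ∀ R → (∀ i j → T (rel R i j) → ¬ T (rel R j i)) →
                 Σ (Fin LK) (λ e → T (lookup (support R) e)) ↔ Σ (Fin d) (λ i → Σ (Fin d) (λ j → T (rel R i j)))
  support↔arcs R antisymmetric =
    Σ-fibres (λ e → ≡⇒↔ (cong T (lookup∘tabulate _ e))) ⟨↔⟩ Σ-reindex label ⟨↔⟩
    Σ-fibres (λ (i , j , _) → T-∨-exclusive (λ (a , b) → antisymmetric i j a b)) ⟨↔⟩ Σ-distribˡ-⊎ ⟨↔⟩
    distinct-pairs (λ i j → T (rel R i j)) (λ i a → antisymmetric i i a a)

  Touches : Rel d → Fin d → Fin d → Set
  Touches R x y = T (rel R x y) ⊎ T (rel R y x)

  module FromOrientedMatching {m : ℕ} (R : Rel d) (ok : OrientedMatching m R) where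

    functional : Functional R
    functional = proj₁ ok

    cofunctional : Cofunctional R
    cofunctional = proj₁ (proj₂ ok)

    no-two-step : NoTwoStep R
    no-two-step = proj₁ (proj₂ (proj₂ ok))

    size : ∣ tabulate (dom R) ∣ ≡ m
    size = proj₂ (proj₂ (proj₂ ok))

    antisymmetric : ∀ i j → T (rel R i j) → ¬ T (rel R j i)
    antisymmetric i j a b = no-two-step i j i a b

    touches-unique : ∀ {x y z} → Touches R x y → Touches R x z → y ≡ z
    touches-unique {x} {y} {z} (inj₁ a) (inj₁ b) = functional x y z a b
    touches-unique {x} {y} {z} (inj₁ a) (inj₂ b) = ⊥-elim (no-two-step z x y b a)
    touches-unique {x} {y} {z} (inj₂ a) (inj₁ b) = ⊥-elim (no-two-step y x z a b)
    touches-unique {x} {y} {z} (inj₂ a) (inj₂ b) = cofunctional y z x a b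

    support-touches : ∀ e → e ∈ₛ support R → ∀ {v w} → Joins e v w → Touches R v w
    support-touches e p j = along j (Inverse.to (T-∨-exclusive (λ (a , b) → antisymmetric _ _ a b))
                                                (subst T (lookup∘tabulate _ e) (∈⇒T p)))
      where
      swap : ∀ {x y} → Touches R x y → Touches R y x
      swap (inj₁ a) = inj₂ a
      swap (inj₂ a) = inj₁ a
      along : ∀ {v w} → Joins e v w → Touches R (tail e) (head e) → Touches R v w
      along (inj₁ (refl , refl)) t = t
      along (inj₂ (refl , refl)) t = swap t

    support-matching : IsMatching (K d) (support R)
    support-matching = loop-free , sharing-coincide⇒disjoint (K d) (support R) coincide
      where
      loop-free : ∀ e → e ∈ₛ support R → ¬ IsLoop (K d) e
      loop-free e _ loop = tail≢head e (trans (cong proj₁ (sym (ends-K e))) (trans loop (cong proj₂ (ends-K e))))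
      coincide : SharingCoincide (K d) (support R)
      coincide e e' v p p' at at' =
        let (w , j) = incident-joins e v at
            (w' , j') = incident-joins e' v at'
            w≡w' = touches-unique (support-touches e p j) (support-touches e' p' j')
        in joins-unique j (subst (Joins e' v) (sym w≡w') j')

    support-size : ∣ support R ∣ ≡ m
    support-size = ↔⇒≡ (members (support R) ⟨↔⟩ support↔arcs R antisymmetric ⟨↔⟩
      Σ-fibres (λ i → ↔-sym (someᵇ-unique (rel R i) (functional i))) ⟨↔⟩ ↔-sym (members-tabulate (dom R)) ⟨↔⟩
      ≡⇒↔ (cong Fin size))

    reversed⊆support : T (reversed R ⊆ᵇ support R)
    reversed⊆support = ⊆ᵇ-complete (reversed R) (support R) λ e t →
      subst T (sym (lookup∘tabulate _ e)) (Inverse.from (T-∨-exclusive (λ (a , b) → antisymmetric _ _ a b))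
                                                        (inj₂ (subst T (lookup∘tabulate _ e) t)))

    orient-support : orient (support R) (reversed R) ≡ R
    orient-support = vec-ext λ i → vec-ext λ j → trans (rel-orient _ _ i j (compare i j)) (at i j (compare i j))
      where
      at : ∀ i j (o : Order i j) → orientᵇ (support R) (reversed R) i j o ≡ rel R i j
      at i j (inj₁ t) = trans (cong₂ (λ s r → s ∧ not r) (support-at R (i , j , t)) (reversed-at R (i , j , t)))
                              (exclusive-or-not (antisymmetric i j))
      at i j (inj₂ (inj₁ t)) = trans (cong₂ _∧_ (support-at R (j , i , t)) (reversed-at R (j , i , t)))
                                     (or-and-absorb (rel R j i) (rel R i j))
      at i .i (inj₂ (inj₂ refl)) = sym (Equivalence.to T-not-≡ (¬T⇒T-not (λ a → antisymmetric i i a a)))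

  module FromMatching {m : ℕ} (N Tt : Subset LK) (matching : IsMatching (K d) N) (N-size : ∣ N ∣ ≡ m)
                      (Tt⊆N : T (Tt ⊆ᵇ N)) where

    R : Rel d
    R = orient N Tt

    Along : Fin LK → Fin d → Fin d → Set
    Along e i j = (tail e ≡ i × head e ≡ j × T (not (lookup Tt e))) ⊎ (tail e ≡ j × head e ≡ i × T (lookup Tt e))

    arc-along : ∀ i j → T (rel R i j) → Σ (Fin LK) (λ e → e ∈ₛ N × Along e i j)
    arc-along i j a = from-order (compare i j) (subst T (rel-orient N Tt i j (compare i j)) a)
      where
      from-order : (o : Order i j) → T (orientᵇ N Tt i j o) → Σ (Fin LK) (λ e → e ∈ₛ N × Along e i j)
      from-order (inj₁ t) a = let (n , r) = Equivalence.to T-∧ a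
        in edge (i , j , t) , T⇒∈ n , inj₁ (tail-edge _ , head-edge _ , r)
      from-order (inj₂ (inj₁ t)) a = let (n , r) = Equivalence.to T-∧ a
        in edge (j , i , t) , T⇒∈ n , inj₂ (tail-edge _ , head-edge _ , r)

    along-tail : ∀ {e i j} → Along e i j → Incident (K d) e i
    along-tail {e} (inj₁ (p , _)) = inj₁ (trans (cong proj₁ (ends-K e)) p)
    along-tail {e} (inj₂ (_ , q , _)) = inj₂ (trans (cong proj₂ (ends-K e)) q)

    along-head : ∀ {e i j} → Along e i j → Incident (K d) e j
    along-head {e} (inj₁ (_ , q , _)) = inj₂ (trans (cong proj₂ (ends-K e)) q)
    along-head {e} (inj₂ (p , _)) = inj₁ (trans (cong proj₁ (ends-K e)) p)

    coincide : SharingCoincide (K d) N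
    coincide = disjoint⇒sharing-coincide (K d) N (proj₂ matching)

    along-functional : ∀ e {i j j'} → Along e i j → Along e i j' → j ≡ j'
    along-functional e (inj₁ (_ , q , _)) (inj₁ (_ , q' , _)) = trans (sym q) q'
    along-functional e (inj₁ (_ , _ , n)) (inj₂ (_ , _ , t)) = ⊥-elim (T-not⇒¬T n t)
    along-functional e (inj₂ (_ , _ , t)) (inj₁ (_ , _ , n)) = ⊥-elim (T-not⇒¬T n t)
    along-functional e (inj₂ (p , _)) (inj₂ (p' , _)) = trans (sym p) p'

    along-cofunctional : ∀ e {i i' j} → Along e i j → Along e i' j → i ≡ i'
    along-cofunctional e (inj₁ (p , _)) (inj₁ (p' , _)) = trans (sym p) p'
    along-cofunctional e (inj₁ (_ , _ , n)) (inj₂ (_ , _ , t)) = ⊥-elim (T-not⇒¬T n t)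
    along-cofunctional e (inj₂ (_ , _ , t)) (inj₁ (_ , _ , n)) = ⊥-elim (T-not⇒¬T n t)
    along-cofunctional e (inj₂ (_ , q , _)) (inj₂ (_ , q' , _)) = trans (sym q) q'

    along-no-two-step : ∀ e {i j k} → Along e i j → Along e j k → ⊥
    along-no-two-step e (inj₁ (_ , q , _)) (inj₁ (p' , _)) = tail≢head e (trans p' (sym q))
    along-no-two-step e (inj₁ (_ , _ , n)) (inj₂ (_ , _ , t)) = T-not⇒¬T n t
    along-no-two-step e (inj₂ (_ , _ , t)) (inj₁ (_ , _ , n)) = T-not⇒¬T n t
    along-no-two-step e (inj₂ (p , _)) (inj₂ (_ , q' , _)) = tail≢head e (trans p (sym q'))

    meet : ∀ {i j i' j'} v (a : T (rel R i j)) (a' : T (rel R i' j')) →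
           (∀ {e} → Along e i j → Incident (K d) e v) → (∀ {e} → Along e i' j' → Incident (K d) e v) →
           Σ (Fin LK) (λ e → Along e i j × Along e i' j')
    meet {i} {j} {i'} {j'} v a a' at at' =
      let (e , n , al) = arc-along i j a
          (e' , n' , al') = arc-along i' j' a'
      in e , al , subst (λ e → Along e i' j') (sym (coincide e e' v n n' (at al) (at' al'))) al'

    functional : Functional R
    functional i j j' a a' = let (e , al , al') = meet i a a' along-tail along-tail in along-functional e al al'

    cofunctional : Cofunctional R
    cofunctional i i' j a a' = let (e , al , al') = meet j a a' along-head along-head in along-cofunctional e al al'

    no-two-step : NoTwoStep R
    no-two-step i j k a a' = let (e , al , al') = meet j a a' along-head along-tail in along-no-two-step e al al'

    forward-at : ∀ e → rel R (tail e) (head e) ≡ lookup N e ∧ not (lookup Tt e)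
    forward-at e = trans (rel-orient N Tt _ _ (inj₁ (ordered e)))
                         (cong (λ e → lookup N e ∧ not (lookup Tt e)) (edge-ends e (ordered e)))

    backward-at : ∀ e → rel R (head e) (tail e) ≡ lookup N e ∧ lookup Tt e
    backward-at e = trans (rel-orient N Tt _ _ (inj₂ (inj₁ (ordered e))))
                          (cong (λ e → lookup N e ∧ lookup Tt e) (edge-ends e (ordered e)))

    support-orient : support R ≡ N
    support-orient = vec-ext λ e → trans (lookup∘tabulate _ e)
      (trans (cong₂ _∨_ (forward-at e) (backward-at e)) (and-not-or-and (lookup N e) (lookup Tt e)))

    reversed-orient : reversed R ≡ Tt
    reversed-orient = vec-ext λ e → trans (lookup∘tabulate _ e)
      (trans (backward-at e) (and-subsumed (⊆ᵇ-sound Tt N Tt⊆N e)))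

    orient-oriented : OrientedMatching m R
    orient-oriented = functional , cofunctional , no-two-step , ↔⇒≡
      (members-tabulate (dom R) ⟨↔⟩ Σ-fibres (λ i → someᵇ-unique (rel R i) (functional i)) ⟨↔⟩
       ↔-sym (support↔arcs R (λ i j a b → no-two-step i j i a b)) ⟨↔⟩
       ≡⇒↔ (cong (λ X → Σ (Fin LK) (λ e → T (lookup X e))) support-orient) ⟨↔⟩ ↔-sym (members N) ⟨↔⟩
       ≡⇒↔ (cong Fin N-size))

  OrientedEdges : ℕ → Set
  OrientedEdges m = Σ (Subset LK) (λ N → SizedMatching (K d) m N × Σ (Subset LK) (λ Tt → T (Tt ⊆ᵇ N)))

  oriented↔oriented-edges : ∀ m → OrientedMatchings d m ↔ OrientedEdges m
  oriented↔oriented-edges m = mk↔ₛ′ to from to∘from from∘to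
    where
    to : OrientedMatchings d m → OrientedEdges m
    to (R , ok) = support R , fromWitness {a? = isMatching? (K d) (support R) ×-dec (∣ support R ∣ ≟ℕ m)} (support-matching , support-size) ,
                  reversed R , reversed⊆support
      where open FromOrientedMatching R (toWitness ok)
    from : OrientedEdges m → OrientedMatchings d m
    from (N , q , Tt , sub) = orient N Tt , fromWitness {a? = orientedMatching? m (orient N Tt)} orient-oriented
      where open FromMatching N Tt (proj₁ (toWitness q)) (proj₂ (toWitness q)) sub
    to∘from : ∀ y → to (from y) ≡ y
    to∘from (N , q , Tt , sub) = same support-orient reversed-orient
      where
      open FromMatching N Tt (proj₁ (toWitness q)) (proj₂ (toWitness q)) sub
      same : ∀ {N' Tt' q' sub'} → N' ≡ N → Tt' ≡ Tt → _≡_ {A = OrientedEdges m} (N' , q' , Tt' , sub') (N , q , Tt , sub)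
      same {q' = q'} {sub'} refl refl = cong₂ (λ q sub → N , q , Tt , sub) (T-irrelevant q' q) (T-irrelevant sub' sub)
    from∘to : ∀ x → from (to x) ≡ x
    from∘to (R , ok) = Σ-≡ (λ _ → T-irrelevant) (FromOrientedMatching.orient-support R (toWitness ok))

  orientations-count : ∀ m → OrientedEdges m ↔ (Σ (Subset LK) (SizedMatching (K d) m) × Fin (2 ^ m))
  orientations-count m = Σ-fibres (λ N → Σ-fibres (λ q → subsets-of N ⟨↔⟩ ≡⇒↔ (cong (λ k → Fin (2 ^ k)) (proj₂ (toWitness q))))) ⟨↔⟩
    mk↔ₛ′ (λ (N , q , c) → (N , q) , c) (λ ((N , q) , c) → N , q , c) (λ _ → refl) (λ _ → refl)

-- Proposition 5.4.  Reading the right-hand side as pairs (σ , M), the chain of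
-- bijections reads: M as a set of tails; (σ , M) as an oriented matching with an
-- extension; the (d ∸ m)! extensions; the oriented matching as an m-matching of
-- K_d with a set of reversed edges, of which there are 2^m.
proposition5p4 : (d m : ℕ) → 1 ≤ d → m ≤ d →
    2 ^ m * (d ∸ m) ! * a (K d) m ≡ sum (map (λ σ → a (Gσ σ) m) (Sym d))
proposition5p4 d m _ _ = ↔⇒≡ (lhs-count d m ⟨↔⟩ reorder ⟨↔⟩ ↔-sym (
  rhs-count d m ⟨↔⟩
  Σ-fibres (λ σ → ↔-refl ×-↔ matchings↔labelled (Gσ-labelling σ) m) ⟨↔⟩
  PermutationWithMatching.pairs↔extended-matchings ⟨↔⟩
  Σ-fibres (λ (R , ok) → let (functional , cofunctional , _ , size) = toWitness ok
                          in Extension-count.extensions-count R functional cofunctional size) ⟨↔⟩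
  (Orientations.oriented↔oriented-edges {d} m ⟨↔⟩ Orientations.orientations-count {d} m) ×-↔ ↔-refl))
  where
  reorder : ∀ {A B C : Set} → ((A × B) × C) ↔ ((C × A) × B)
  reorder = mk↔ₛ′ (λ ((a , b) , c) → (c , a) , b) (λ ((c , a) , b) → (a , b) , c) (λ _ → refl) (λ _ → refl)
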